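{- For $t\ge1$, \[ \sum_{n\ge0} U^{(t)}_n(x)\,z^n=\frac{1}{1-(xz-z^{t+1})} \] as formal power series in $z$.
   Context: For $n\ge 0$, $U^{(t)}_n(x)=\sum_S (-1)^{|S|}x^{\,n-(t+1)|S|}$, where $S$ ranges over all sets of pairwise vertex-disjoint subpaths of the path graph on vertices $1,\dots,n$ (edges $\{i,i+1\}$) each having exactly $t$ edges; $U^{(t)}_0=1$. -}

module Defs where

open import Data.Bool using (Bool; true; false; _∧_; if_then_else_)
open import Data.Nat using (ℕ; zero; suc; _+_; _*_; _∸_; _<ᵇ_; _≤ᵇ_; _≡ᵇ_)
open import Data.Fin using (Fin; toℕ)
open import Data.Vec using (Vec; []; _∷_; lookup)
open import Data.List using (List; []; _∷_; map; _++_; foldr; filter; upTo; allFin; length)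
open import Data.Integer using (ℤ; 0ℤ; 1ℤ; -_) renaming (_+_ to _+ℤ_; _*_ to _*ℤ_)
open import Relation.Nullary.Decidable using (yes; no)
open import Relation.Binary.PropositionalEquality using (_≡_)
open import Data.Bool using (T?)

-- Sets S of pairwise vertex-disjoint subpaths with exactly t edges of the
-- path graph on n vertices.  A subpath with
-- t edges is determined by its leftmost vertex i (it is {i,…,i+t}, which
-- requires i + t < n).  So S is encoded by the subset of Fin n of the
-- leftmost vertices of its members.

allL : {A : Set} → (A → Bool) → List A → Bool
allL p = foldr (λ a b → p a ∧ b) true

subsets : (n : ℕ) → List (Vec Bool n)
subsets zero    = [] ∷ []
subsets (suc n) = map (true ∷_) (subsets n) ++ map (false ∷_) (subsets n)

fits : (t n : ℕ) → Fin n → Bool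
fits t n i = (toℕ i + t) <ᵇ n

-- subpaths starting at i < j (with t edges) are vertex-disjoint
disjoint : (t : ℕ) → ℕ → ℕ → Bool
disjoint t i j = (i + t) <ᵇ j

valid : (t n : ℕ) → Vec Bool n → Bool
valid t n s =
  allL (λ i → if lookup s i then fits t n i else true) (allFin n) ∧
  allL (λ i → allL (λ j → if lookup s i ∧ lookup s j ∧ (toℕ i <ᵇ toℕ j)
                          then disjoint t (toℕ i) (toℕ j) else true)
                 (allFin n))
      (allFin n)

card : {n : ℕ} → Vec Bool n → ℕ
card []           = 0
card (true ∷ s)   = suc (card s)
card (false ∷ s)  = card s

sumℤ : List ℤ → ℤ
sumℤ = foldr _+ℤ_ 0ℤ

signℤ : ℕ → ℤ
signℤ zero    = 1ℤ
signℤ (suc k) = - signℤ k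

-- coefficient of x^m in U^{(t)}_n(x)
--   = Σ_S (-1)^{|S|} [ n - (t+1)|S| = m ]
Ucoeff : (t n m : ℕ) → ℤ
Ucoeff t n m =
  sumℤ (map (λ s → if (m + suc t * card s) ≡ᵇ n then signℤ (card s) else 0ℤ)
            (filter (λ s → T? (valid t n s)) (subsets n)))

-- Formal power series in z with coefficients in ℤ[x]:
-- f n m = coefficient of z^n x^m.

PS : Set
PS = ℕ → ℕ → ℤ

Σ≤ : ℕ → (ℕ → ℤ) → ℤ
Σ≤ n f = sumℤ (map f (upTo (suc n)))

_⊕_ : PS → PS → PS
(f ⊕ g) n m = f n m +ℤ g n m

_⊖_ : PS → PS → PS
(f ⊖ g) n m = f n m +ℤ (- g n m)

_⊛_ : PS → PS → PS
(f ⊛ g) n m = Σ≤ n (λ i → Σ≤ m (λ j → f i j *ℤ g (n ∸ i) (m ∸ j)))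

oneS : PS
oneS zero zero = 1ℤ
oneS _    _    = 0ℤ

zS : PS
zS (suc zero) zero = 1ℤ
zS _          _    = 0ℤ

xS : PS
xS zero (suc zero) = 1ℤ
xS _    _          = 0ℤ

powS : PS → ℕ → PS
powS f zero    = oneS
powS f (suc k) = f ⊛ powS f k

UGF : ℕ → PS
UGF t n m = Ucoeff t n m

module Submission where

-- Vertex 1 of the path is either covered by no member of S, contributing a factor x and leaving
-- a family on the remaining n - 1 vertices, or it is the left end of a member of S, contributing
-- -1 and leaving a family on the last n - t - 1 vertices.  Hence U_n = x U_{n-1} - U_{n-t-1}
-- (with U_0 = 1 and U_k = 0 for k < 0), which says exactly that (1 - xz + z^{t+1}) Σ U_n z^n = 1.

open import Defs
open import Data.Nat using (ℕ; suc; _≤_)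
open import Relation.Binary.PropositionalEquality using (_≡_)

open import Data.Nat using (zero; _+_; _*_; _∸_; _<ᵇ_; _≡ᵇ_)
import Data.Nat.Properties as ℕ
open import Data.Nat.Tactic.RingSolver using (solve-∀)
open import Data.Fin using (Fin; zero; suc; toℕ)
open import Data.Bool using (Bool; true; false; _∧_; if_then_else_; T?)
open import Data.Bool.Properties using (∧-zeroʳ; ∧-identityʳ; ∧-assoc; ∧-commutativeMonoid)
open import Algebra.Bundles using (CommutativeMonoid)
open import Data.Vec using (Vec; []; _∷_; lookup)
open import Data.List using (List; []; _∷_; _++_; map; filter; applyUpTo; upTo; tabulate)
open import Data.List.Properties using (map-cong; map-++; map-∘)
open import Data.Integer using (ℤ; 0ℤ; 1ℤ; -1ℤ; -_) renaming (_+_ to _+ℤ_; _*_ to _*ℤ_)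
import Data.Integer.Properties as ℤ
open import Algebra.Properties.Semiring.Sum ℤ.+-*-semiring
  using (sum-syntax; ∑-distrib-+; *-distribˡ-sum; sum-cong-≗)
open import Algebra.Properties.CommutativeSemigroup ℤ.*-commutativeSemigroup using (x∙yz≈y∙xz)
open import Algebra.Properties.CommutativeSemigroup
  (CommutativeMonoid.commutativeSemigroup ∧-commutativeMonoid) using (interchange)
open import Function using (_∘_; id)
open import Relation.Binary.PropositionalEquality
  using (refl; sym; trans; cong; cong₂; module ≡-Reasoning)

infix 4 _≐_

_≐_ : PS → PS → Set
f ≐ g = ∀ n m → f n m ≡ g n m

∑< : ℕ → (ℕ → ℤ) → ℤ
∑< k f = ∑[ i < k ] f (toℕ i)

∑<-cong : ∀ k {f g : ℕ → ℤ} → (∀ i → f i ≡ g i) → ∑< k f ≡ ∑< k g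
∑<-cong k f≗g = sum-cong-≗ {k} (λ i → f≗g (toℕ i))

sumℤ-applyUpTo : ∀ (f : ℕ → ℤ) (g : ℕ → ℕ) k →
  sumℤ (map f (applyUpTo g k)) ≡ ∑< k (f ∘ g)
sumℤ-applyUpTo f g zero    = refl
sumℤ-applyUpTo f g (suc k) = cong (f (g 0) +ℤ_) (sumℤ-applyUpTo f (g ∘ suc) k)

Σ≤-as-∑< : ∀ n (f : ℕ → ℤ) → Σ≤ n f ≡ ∑< (suc n) f
Σ≤-as-∑< n f = sumℤ-applyUpTo f id (suc n)

∑<-neg : ∀ k (f : ℕ → ℤ) → ∑< k (λ i → - f i) ≡ - ∑< k f
∑<-neg k f = begin
  ∑< k (λ i → - f i)       ≡⟨ ∑<-cong k (λ i → sym (ℤ.-1*i≡-i (f i))) ⟩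
  ∑< k (λ i → -1ℤ *ℤ f i)  ≡⟨ *-distribˡ-sum {k} -1ℤ _ ⟨
  -1ℤ *ℤ ∑< k f            ≡⟨ ℤ.-1*i≡-i _ ⟩
  - ∑< k f                 ∎
  where open ≡-Reasoning

∑<-⊖ : ∀ k (f g : ℕ → ℤ) → ∑< k (λ i → f i +ℤ - g i) ≡ ∑< k f +ℤ - ∑< k g
∑<-⊖ k f g = trans (∑-distrib-+ {k} _ _) (cong (∑< k f +ℤ_) (∑<-neg k g))

⊛-as-∑< : ∀ f g n m →
  (f ⊛ g) n m ≡ ∑< (suc n) (λ i → ∑< (suc m) (λ j → f i j *ℤ g (n ∸ i) (m ∸ j)))
⊛-as-∑< f g n m = trans (Σ≤-as-∑< n (λ i → Σ≤ m (term i)))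
                         (∑<-cong (suc n) (λ i → Σ≤-as-∑< m (term i)))
  where
  term : ℕ → ℕ → ℤ
  term i j = f i j *ℤ g (n ∸ i) (m ∸ j)

⊛-cong : ∀ {f f′ g g′} → f ≐ f′ → g ≐ g′ → f ⊛ g ≐ f′ ⊛ g′
⊛-cong f≐f′ g≐g′ n m = cong sumℤ (map-cong (λ i → cong sumℤ (map-cong (λ j →
  cong₂ _*ℤ_ (f≐f′ i j) (g≐g′ (n ∸ i) (m ∸ j))) (upTo (suc m)))) (upTo (suc n)))

⊛-distribˡ-⊖ : ∀ f g h → f ⊛ (g ⊖ h) ≐ (f ⊛ g) ⊖ (f ⊛ h)
⊛-distribˡ-⊖ f g h n m = begin
  (f ⊛ (g ⊖ h)) n m
    ≡⟨ ⊛-as-∑< f (g ⊖ h) n m ⟩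
  ∑< (suc n) (λ i → ∑< (suc m) (λ j → f i j *ℤ (g ⊖ h) (n ∸ i) (m ∸ j)))
    ≡⟨ ∑<-cong (suc n) (λ i →
         trans (∑<-cong (suc m) (distrib i)) (∑<-⊖ (suc m) (fg i) (fh i))) ⟩
  ∑< (suc n) (λ i → ∑< (suc m) (fg i) +ℤ - ∑< (suc m) (fh i))
    ≡⟨ ∑<-⊖ (suc n) (λ i → ∑< (suc m) (fg i)) (λ i → ∑< (suc m) (fh i)) ⟩
  ∑< (suc n) (λ i → ∑< (suc m) (fg i)) +ℤ - ∑< (suc n) (λ i → ∑< (suc m) (fh i))
    ≡⟨ cong₂ (λ a b → a +ℤ - b) (⊛-as-∑< f g n m) (⊛-as-∑< f h n m) ⟨
  ((f ⊛ g) ⊖ (f ⊛ h)) n m ∎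
  where
  open ≡-Reasoning
  fg fh : ℕ → ℕ → ℤ
  fg i j = f i j *ℤ g (n ∸ i) (m ∸ j)
  fh i j = f i j *ℤ h (n ∸ i) (m ∸ j)
  distrib : ∀ i j → f i j *ℤ (g ⊖ h) (n ∸ i) (m ∸ j) ≡ fg i j +ℤ - fh i j
  distrib i j = trans (ℤ.*-distribˡ-+ (f i j) _ _)
                      (cong (fg i j +ℤ_) (sym (ℤ.neg-distribʳ-* (f i j) _)))

δ : ℕ → ℕ → ℤ
δ zero    zero    = 1ℤ
δ zero    (suc _) = 0ℤ
δ (suc _) zero    = 0ℤ
δ (suc p) (suc a) = δ p a

shift : ℕ → (ℕ → ℤ) → ℕ → ℤ
shift zero    g n       = g n
shift (suc p) g zero    = 0ℤ
shift (suc p) g (suc n) = shift p g n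

shift-cong : ∀ p {g h : ℕ → ℤ} → (∀ i → g i ≡ h i) → ∀ n → shift p g n ≡ shift p h n
shift-cong zero    g≗h n       = g≗h n
shift-cong (suc p) g≗h zero    = refl
shift-cong (suc p) g≗h (suc n) = shift-cong p g≗h n

shift-unfold : ∀ p n (g : ℕ → ℤ) →
  g 0 *ℤ δ p (suc n) +ℤ shift p (g ∘ suc) n ≡ shift p g (suc n)
shift-unfold zero          n       g =
  trans (cong (_+ℤ g (suc n)) (ℤ.*-zeroʳ (g 0))) (ℤ.+-identityˡ _)
shift-unfold (suc zero)    zero    g = trans (ℤ.+-identityʳ _) (ℤ.*-identityʳ (g 0))
shift-unfold (suc (suc p)) zero    g = trans (ℤ.+-identityʳ _) (ℤ.*-zeroʳ (g 0))
shift-unfold (suc p)       (suc n) g = shift-unfold p n g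

∑<-δ : ∀ n p (g : ℕ → ℤ) → ∑< (suc n) (λ i → g i *ℤ δ p (n ∸ i)) ≡ shift p g n
∑<-δ zero    zero    g = trans (ℤ.+-identityʳ _) (ℤ.*-identityʳ (g 0))
∑<-δ zero    (suc p) g = trans (ℤ.+-identityʳ _) (ℤ.*-zeroʳ (g 0))
∑<-δ (suc n) p       g =
  trans (cong (g 0 *ℤ δ p (suc n) +ℤ_) (∑<-δ n p (g ∘ suc))) (shift-unfold p n g)

monomial : ℕ → ℕ → PS
monomial p q a b = δ p a *ℤ δ q b

⊛-monomial : ∀ f p q n m → (f ⊛ monomial p q) n m ≡ shift p (λ i → shift q (f i) m) n
⊛-monomial f p q n m = begin
  (f ⊛ monomial p q) n m
    ≡⟨ ⊛-as-∑< f (monomial p q) n m ⟩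
  ∑< (suc n) (λ i → ∑< (suc m) (λ j → f i j *ℤ (δ p (n ∸ i) *ℤ δ q (m ∸ j))))
    ≡⟨ ∑<-cong (suc n) inner ⟩
  ∑< (suc n) (λ i → shift q (f i) m *ℤ δ p (n ∸ i))
    ≡⟨ ∑<-δ n p (λ i → shift q (f i) m) ⟩
  shift p (λ i → shift q (f i) m) n ∎
  where
  open ≡-Reasoning
  inner : ∀ i →
    ∑< (suc m) (λ j → f i j *ℤ (δ p (n ∸ i) *ℤ δ q (m ∸ j))) ≡ shift q (f i) m *ℤ δ p (n ∸ i)
  inner i = begin
    ∑< (suc m) (λ j → f i j *ℤ (c *ℤ δ q (m ∸ j)))
      ≡⟨ ∑<-cong (suc m) (λ j → x∙yz≈y∙xz (f i j) c (δ q (m ∸ j))) ⟩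
    ∑< (suc m) (λ j → c *ℤ fδ j)  ≡⟨ *-distribˡ-sum {suc m} c (fδ ∘ toℕ) ⟨
    c *ℤ ∑< (suc m) fδ            ≡⟨ cong (c *ℤ_) (∑<-δ m q (f i)) ⟩
    c *ℤ shift q (f i) m          ≡⟨ ℤ.*-comm c _ ⟩
    shift q (f i) m *ℤ c          ∎
    where
    c : ℤ
    c = δ p (n ∸ i)
    fδ : ℕ → ℤ
    fδ j = f i j *ℤ δ q (m ∸ j)

shift-monomialʳ : ∀ p q s a m → shift s (monomial p q a) m ≡ monomial p (s + q) a m
shift-monomialʳ p q zero    a m       = refl
shift-monomialʳ p q (suc s) a zero    = sym (ℤ.*-zeroʳ (δ p a))
shift-monomialʳ p q (suc s) a (suc m) = shift-monomialʳ p q s a m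

shift-monomialˡ : ∀ p q r n m → shift r (λ a → monomial p q a m) n ≡ monomial (r + p) q n m
shift-monomialˡ p q zero    n       m = refl
shift-monomialˡ p q (suc r) zero    m = refl
shift-monomialˡ p q (suc r) (suc n) m = shift-monomialˡ p q r n m

monomial-⊛-monomial : ∀ p q r s → monomial p q ⊛ monomial r s ≐ monomial (p + r) (q + s)
monomial-⊛-monomial p q r s n m = begin
  (monomial p q ⊛ monomial r s) n m
    ≡⟨ ⊛-monomial (monomial p q) r s n m ⟩
  shift r (λ i → shift s (monomial p q i) m) n
    ≡⟨ shift-cong r (λ i → shift-monomialʳ p q s i m) n ⟩
  shift r (λ i → monomial p (s + q) i m) n
    ≡⟨ shift-monomialˡ p (s + q) r n m ⟩
  monomial (r + p) (s + q) n m
    ≡⟨ cong₂ (λ a b → monomial a b n m) (ℕ.+-comm r p) (ℕ.+-comm s q) ⟩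
  monomial (p + r) (q + s) n m ∎
  where open ≡-Reasoning

oneS≐monomial : oneS ≐ monomial 0 0
oneS≐monomial zero    zero    = refl
oneS≐monomial zero    (suc m) = refl
oneS≐monomial (suc n) m       = refl

zS≐monomial : zS ≐ monomial 1 0
zS≐monomial zero          m       = refl
zS≐monomial (suc zero)    zero    = refl
zS≐monomial (suc zero)    (suc m) = refl
zS≐monomial (suc (suc n)) m       = refl

xS≐monomial : xS ≐ monomial 0 1
xS≐monomial zero    zero          = refl
xS≐monomial zero    (suc zero)    = refl
xS≐monomial zero    (suc (suc m)) = refl
xS≐monomial (suc n) m             = refl

xS⊛zS≐monomial : xS ⊛ zS ≐ monomial 1 1
xS⊛zS≐monomial n m =
  trans (⊛-cong xS≐monomial zS≐monomial n m) (monomial-⊛-monomial 0 1 1 0 n m)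

powS-zS≐monomial : ∀ k → powS zS k ≐ monomial k 0
powS-zS≐monomial zero    = oneS≐monomial
powS-zS≐monomial (suc k) n m =
  trans (⊛-cong zS≐monomial (powS-zS≐monomial k) n m) (monomial-⊛-monomial 1 0 k 0 n m)

recurrence⇒⊛-inverse : ∀ t (V : PS) →
  (∀ m → V 0 m ≡ oneS 0 m) →
  (∀ n m → V (suc n) m ≡ shift 1 (V n) m +ℤ - shift t (λ i → V i m) n) →
  V ⊛ (oneS ⊖ ((xS ⊛ zS) ⊖ powS zS (suc t))) ≐ oneS
recurrence⇒⊛-inverse t V V-zero V-suc n m = begin
  (V ⊛ (oneS ⊖ ((xS ⊛ zS) ⊖ powS zS (suc t)))) n m
    ≡⟨ ⊛-cong {V} (λ _ _ → refl) denominator n m ⟩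
  (V ⊛ (one ⊖ (xz ⊖ zᵗ⁺¹))) n m
    ≡⟨ ⊛-distribˡ-⊖ V one (xz ⊖ zᵗ⁺¹) n m ⟩
  (V ⊛ one) n m +ℤ - (V ⊛ (xz ⊖ zᵗ⁺¹)) n m
    ≡⟨ cong (λ x → (V ⊛ one) n m +ℤ - x) (⊛-distribˡ-⊖ V xz zᵗ⁺¹ n m) ⟩
  (V ⊛ one) n m +ℤ - ((V ⊛ xz) n m +ℤ - (V ⊛ zᵗ⁺¹) n m)
    ≡⟨ cong₂ (λ x y → x +ℤ - y) (⊛-monomial V 0 0 n m)
         (cong₂ (λ y z → y +ℤ - z) (⊛-monomial V 1 1 n m) (⊛-monomial V (suc t) 0 n m)) ⟩
  V n m +ℤ - (shift 1 (λ i → shift 1 (V i) m) n +ℤ - shift (suc t) (λ i → V i m) n)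
    ≡⟨ cancel n ⟩
  oneS n m ∎
  where
  open ≡-Reasoning
  one xz zᵗ⁺¹ : PS
  one  = monomial 0 0
  xz   = monomial 1 1
  zᵗ⁺¹ = monomial (suc t) 0
  denominator : oneS ⊖ ((xS ⊛ zS) ⊖ powS zS (suc t)) ≐ one ⊖ (xz ⊖ zᵗ⁺¹)
  denominator a b = cong₂ (λ x y → x +ℤ - y) (oneS≐monomial a b)
    (cong₂ (λ x y → x +ℤ - y) (xS⊛zS≐monomial a b) (powS-zS≐monomial (suc t) a b))
  cancel : ∀ n → V n m +ℤ - (shift 1 (λ i → shift 1 (V i) m) n +ℤ - shift (suc t) (λ i → V i m) n)
                ≡ oneS n m
  cancel zero    = trans (ℤ.+-identityʳ _) (V-zero m)
  cancel (suc n) = trans (cong (λ x → x +ℤ - next) (V-suc n m)) (ℤ.+-inverseʳ next)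
    where next = shift 1 (V n) m +ℤ - shift t (λ i → V i m) n

sumℤ-++ : ∀ (xs ys : List ℤ) → sumℤ (xs ++ ys) ≡ sumℤ xs +ℤ sumℤ ys
sumℤ-++ []       ys = sym (ℤ.+-identityˡ _)
sumℤ-++ (x ∷ xs) ys = trans (cong (x +ℤ_) (sumℤ-++ xs ys)) (sym (ℤ.+-assoc x _ _))

sumℤ-map-neg : ∀ {A : Set} (f : A → ℤ) xs → sumℤ (map (λ x → - f x) xs) ≡ - sumℤ (map f xs)
sumℤ-map-neg f []       = refl
sumℤ-map-neg f (x ∷ xs) =
  trans (cong (- f x +ℤ_) (sumℤ-map-neg f xs)) (sym (ℤ.neg-distrib-+ (f x) _))

sumℤ-map-0 : ∀ {A : Set} (xs : List A) → sumℤ (map (λ _ → 0ℤ) xs) ≡ 0ℤ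
sumℤ-map-0 []       = refl
sumℤ-map-0 (x ∷ xs) = trans (ℤ.+-identityˡ _) (sumℤ-map-0 xs)

sumℤ-map-filter : ∀ {A : Set} (p : A → Bool) (f : A → ℤ) xs →
  sumℤ (map f (filter (λ x → T? (p x)) xs)) ≡ sumℤ (map (λ x → if p x then f x else 0ℤ) xs)
sumℤ-map-filter p f []       = refl
sumℤ-map-filter p f (x ∷ xs) with p x
... | true  = cong (f x +ℤ_) (sumℤ-map-filter p f xs)
... | false = trans (sumℤ-map-filter p f xs) (sym (ℤ.+-identityˡ _))

sumSubsets : ∀ n → (Vec Bool n → ℤ) → ℤ
sumSubsets n h = sumℤ (map h (subsets n))

sumSubsets-suc : ∀ n (h : Vec Bool (suc n) → ℤ) →
  sumSubsets (suc n) h ≡ sumSubsets n (h ∘ (true ∷_)) +ℤ sumSubsets n (h ∘ (false ∷_))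
sumSubsets-suc n h = begin
  sumℤ (map h (withHead true ++ withHead false))
    ≡⟨ cong sumℤ (map-++ h (withHead true) (withHead false)) ⟩
  sumℤ (map h (withHead true) ++ map h (withHead false))
    ≡⟨ sumℤ-++ (map h (withHead true)) (map h (withHead false)) ⟩
  sumℤ (map h (withHead true)) +ℤ sumℤ (map h (withHead false))
    ≡⟨ cong₂ (λ xs ys → sumℤ xs +ℤ sumℤ ys) (map-∘ (subsets n)) (map-∘ (subsets n)) ⟨
  sumSubsets n (h ∘ (true ∷_)) +ℤ sumSubsets n (h ∘ (false ∷_)) ∎
  where
  open ≡-Reasoning
  withHead : Bool → List (Vec Bool (suc n))
  withHead b = map (b ∷_) (subsets n)

≡ᵇ-+-cancelˡ : ∀ a m u → (a + m ≡ᵇ a + u) ≡ (m ≡ᵇ u)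
≡ᵇ-+-cancelˡ zero    m u = refl
≡ᵇ-+-cancelˡ (suc a) m u = ≡ᵇ-+-cancelˡ a m u

everyFin : ∀ n → (Fin n → Bool) → Bool
everyFin zero    p = true
everyFin (suc n) p = p zero ∧ everyFin n (p ∘ suc)

allL-tabulate : ∀ {A : Set} n (p : A → Bool) (f : Fin n → A) →
  allL p (tabulate f) ≡ everyFin n (p ∘ f)
allL-tabulate zero    p f = refl
allL-tabulate (suc n) p f = cong (p (f zero) ∧_) (allL-tabulate n p (f ∘ suc))

everyFin-cong : ∀ n {p q : Fin n → Bool} → (∀ i → p i ≡ q i) → everyFin n p ≡ everyFin n q
everyFin-cong zero    p≗q = refl
everyFin-cong (suc n) p≗q = cong₂ _∧_ (p≗q zero) (everyFin-cong n (p≗q ∘ suc))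

everyFin-true : ∀ n → everyFin n (λ _ → true) ≡ true
everyFin-true zero    = refl
everyFin-true (suc n) = everyFin-true n

module Packings (t : ℕ) where

  fitsAll : ∀ {n} → Vec Bool n → Bool
  fitsAll {n} s = everyFin n (λ i → if lookup s i then fits t n i else true)

  disjointPair : ∀ {n} → Vec Bool n → Fin n → Fin n → Bool
  disjointPair s i j =
    if lookup s i ∧ lookup s j ∧ (toℕ i <ᵇ toℕ j) then disjoint t (toℕ i) (toℕ j) else true

  disjointAll : ∀ {n} → Vec Bool n → Bool
  disjointAll {n} s = everyFin n (λ i → everyFin n (disjointPair s i))

  startsFrom : ∀ {n} → ℕ → Vec Bool n → Bool
  startsFrom {n} k s = everyFin n (λ j → if lookup s j then k <ᵇ suc (toℕ j) else true)

  valid≡fitsAll∧disjointAll : ∀ n (s : Vec Bool n) → valid t n s ≡ fitsAll s ∧ disjointAll s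
  valid≡fitsAll∧disjointAll n s = cong₂ _∧_ (allL-tabulate n _ id)
    (trans (allL-tabulate n _ id) (everyFin-cong n (λ i → allL-tabulate n _ id)))

  disjointAll-false : ∀ {n} (s : Vec Bool n) → disjointAll (false ∷ s) ≡ disjointAll s
  disjointAll-false {n} s = cong₂ _∧_ (everyFin-true n)
    (everyFin-cong n (λ i → cong (λ b → (if b then _ else true) ∧ everyFin n (disjointPair s i))
                                 (∧-zeroʳ (lookup s i))))

  disjointAll-true : ∀ {n} (s : Vec Bool n) →
    disjointAll (true ∷ s) ≡ startsFrom t s ∧ disjointAll s
  disjointAll-true {n} s = cong₂ _∧_
    (everyFin-cong n (λ j → cong (λ b → if b then _ else true) (∧-identityʳ (lookup s j))))
    (everyFin-cong n (λ i → cong (λ b → (if b then _ else true) ∧ everyFin n (disjointPair s i))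
                                 (∧-zeroʳ (lookup s i))))

  valid-false : ∀ n (s : Vec Bool n) → valid t (suc n) (false ∷ s) ≡ valid t n s
  valid-false n s = begin
    valid t (suc n) (false ∷ s)          ≡⟨ valid≡fitsAll∧disjointAll (suc n) (false ∷ s) ⟩
    fitsAll s ∧ disjointAll (false ∷ s)  ≡⟨ cong (fitsAll s ∧_) (disjointAll-false s) ⟩
    fitsAll s ∧ disjointAll s            ≡⟨ valid≡fitsAll∧disjointAll n s ⟨
    valid t n s                          ∎
    where open ≡-Reasoning

  valid-true : ∀ n (s : Vec Bool n) →
    valid t (suc n) (true ∷ s) ≡ (t <ᵇ suc n) ∧ (startsFrom t s ∧ valid t n s)
  valid-true n s = begin
    valid t (suc n) (true ∷ s)
      ≡⟨ valid≡fitsAll∧disjointAll (suc n) (true ∷ s) ⟩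
    ((t <ᵇ suc n) ∧ fitsAll s) ∧ disjointAll (true ∷ s)
      ≡⟨ cong (((t <ᵇ suc n) ∧ fitsAll s) ∧_) (disjointAll-true s) ⟩
    ((t <ᵇ suc n) ∧ fitsAll s) ∧ (startsFrom t s ∧ disjointAll s)
      ≡⟨ interchange (t <ᵇ suc n) (fitsAll s) (startsFrom t s) (disjointAll s) ⟩
    ((t <ᵇ suc n) ∧ startsFrom t s) ∧ (fitsAll s ∧ disjointAll s)
      ≡⟨ ∧-assoc (t <ᵇ suc n) (startsFrom t s) _ ⟩
    (t <ᵇ suc n) ∧ (startsFrom t s ∧ (fitsAll s ∧ disjointAll s))
      ≡⟨ cong (λ b → (t <ᵇ suc n) ∧ (startsFrom t s ∧ b)) (valid≡fitsAll∧disjointAll n s) ⟨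
    (t <ᵇ suc n) ∧ (startsFrom t s ∧ valid t n s) ∎
    where open ≡-Reasoning

  -- validAfter k s: s is valid when its first k vertices are still covered by a subpath starting
  -- to their left (so they must exist and start no subpath); uncovered k s counts the vertices
  -- covered by no subpath.
  validAfter : ∀ {n} → ℕ → Vec Bool n → Bool
  validAfter zero    []          = true
  validAfter (suc k) []          = false
  validAfter zero    (false ∷ s) = validAfter zero s
  validAfter zero    (true ∷ s)  = validAfter t s
  validAfter (suc k) (false ∷ s) = validAfter k s
  validAfter (suc k) (true ∷ s)  = false

  uncovered : ∀ {n} → ℕ → Vec Bool n → ℕ
  uncovered k       []          = 0
  uncovered zero    (false ∷ s) = suc (uncovered zero s)
  uncovered zero    (true ∷ s)  = uncovered t s
  uncovered (suc k) (b ∷ s)     = uncovered k s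

  startsFrom-zero : ∀ {n} (s : Vec Bool n) → startsFrom 0 s ≡ true
  startsFrom-zero []          = refl
  startsFrom-zero (true ∷ s)  = startsFrom-zero s
  startsFrom-zero (false ∷ s) = startsFrom-zero s

  validAfter-split : ∀ {n} k (s : Vec Bool n) →
    validAfter k s ≡ (k <ᵇ suc n) ∧ (startsFrom k s ∧ validAfter 0 s)
  validAfter-split zero    []          = refl
  validAfter-split zero    (b ∷ s)     = cong (_∧ validAfter 0 (b ∷ s)) (sym (startsFrom-zero (b ∷ s)))
  validAfter-split (suc k) []          = refl
  validAfter-split (suc k) (false ∷ s) = validAfter-split k s
  validAfter-split (suc k) (true ∷ s)  = sym (∧-zeroʳ _)

  valid≡validAfter : ∀ n (s : Vec Bool n) → valid t n s ≡ validAfter 0 s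
  valid≡validAfter zero    []          = refl
  valid≡validAfter (suc n) (false ∷ s) = trans (valid-false n s) (valid≡validAfter n s)
  valid≡validAfter (suc n) (true ∷ s)  = begin
    valid t (suc n) (true ∷ s)
      ≡⟨ valid-true n s ⟩
    (t <ᵇ suc n) ∧ (startsFrom t s ∧ valid t n s)
      ≡⟨ cong (λ b → (t <ᵇ suc n) ∧ (startsFrom t s ∧ b)) (valid≡validAfter n s) ⟩
    (t <ᵇ suc n) ∧ (startsFrom t s ∧ validAfter 0 s)
      ≡⟨ validAfter-split t s ⟨
    validAfter t s ∎
    where open ≡-Reasoning

  vertex-count : ∀ {n} k (s : Vec Bool n) → validAfter k s ≡ true →
    k + suc t * card s + uncovered k s ≡ n
  vertex-count zero    []          _  = trans (ℕ.+-identityʳ _) (ℕ.*-zeroʳ (suc t))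
  vertex-count zero    (false ∷ s) ok = trans (ℕ.+-suc _ _) (cong suc (vertex-count 0 s ok))
  vertex-count zero    (true ∷ s)  ok =
    cong suc (trans (cong (_+ uncovered t s) (path-then-rest (card s) t)) (vertex-count t s ok))
    where
    path-then-rest : ∀ c r → c + r * suc c ≡ r + suc r * c
    path-then-rest = solve-∀
  vertex-count (suc k) (false ∷ s) ok = cong suc (vertex-count k s ok)

  weight : ∀ {n} → ℕ → Vec Bool n → ℕ → ℤ
  weight k s m =
    if validAfter k s then (if m ≡ᵇ uncovered k s then signℤ (card s) else 0ℤ) else 0ℤ

  Ucoeff-summand : ∀ n (s : Vec Bool n) m →
    (if valid t n s then (if m + suc t * card s ≡ᵇ n then signℤ (card s) else 0ℤ) else 0ℤ)
      ≡ weight 0 s m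
  Ucoeff-summand n s m rewrite valid≡validAfter n s with validAfter 0 s in ok
  ... | false = refl
  ... | true  = cong (λ b → if b then signℤ (card s) else 0ℤ) (begin
    (m + X ≡ᵇ n)      ≡⟨ cong (m + X ≡ᵇ_) (sym (vertex-count 0 s ok)) ⟩
    (m + X ≡ᵇ X + u)  ≡⟨ cong (_≡ᵇ X + u) (ℕ.+-comm m X) ⟩
    (X + m ≡ᵇ X + u)  ≡⟨ ≡ᵇ-+-cancelˡ X m u ⟩
    (m ≡ᵇ u)          ∎)
    where
    open ≡-Reasoning
    X u : ℕ
    X = suc t * card s
    u = uncovered 0 s

  signedCount : ℕ → ℕ → ℕ → ℤ
  signedCount k n m = sumSubsets n (λ s → weight k s m)

  Ucoeff≡signedCount : ∀ n m → Ucoeff t n m ≡ signedCount 0 n m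
  Ucoeff≡signedCount n m = trans (sumℤ-map-filter (valid t n) _ (subsets n))
                                 (cong sumℤ (map-cong (λ s → Ucoeff-summand n s m) (subsets n)))

  weight-true : ∀ {n} (s : Vec Bool n) m → weight 0 (true ∷ s) m ≡ - weight t s m
  weight-true s m with validAfter t s | m ≡ᵇ uncovered t s
  ... | true  | true  = refl
  ... | true  | false = refl
  ... | false | _     = refl

  weight-false-zero : ∀ {n} (s : Vec Bool n) → weight 0 (false ∷ s) 0 ≡ 0ℤ
  weight-false-zero s with validAfter 0 s
  ... | true  = refl
  ... | false = refl

  signedCount-suc : ∀ n m →
    signedCount 0 (suc n) m ≡ shift 1 (signedCount 0 n) m +ℤ - signedCount t n m
  signedCount-suc n m = begin
    signedCount 0 (suc n) m
      ≡⟨ sumSubsets-suc n (λ s → weight 0 s m) ⟩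
    sumSubsets n (λ s → weight 0 (true ∷ s) m) +ℤ sumSubsets n (λ s → weight 0 (false ∷ s) m)
      ≡⟨ cong₂ _+ℤ_ (trans (cong sumℤ (map-cong (λ s → weight-true s m) (subsets n)))
                           (sumℤ-map-neg (λ s → weight t s m) (subsets n)))
                    (first-vertex-uncovered m) ⟩
    - signedCount t n m +ℤ shift 1 (signedCount 0 n) m
      ≡⟨ ℤ.+-comm (- signedCount t n m) (shift 1 (signedCount 0 n) m) ⟩
    shift 1 (signedCount 0 n) m +ℤ - signedCount t n m ∎
    where
    open ≡-Reasoning
    first-vertex-uncovered : ∀ m →
      sumSubsets n (λ s → weight 0 (false ∷ s) m) ≡ shift 1 (signedCount 0 n) m
    first-vertex-uncovered zero    =
      trans (cong sumℤ (map-cong weight-false-zero (subsets n))) (sumℤ-map-0 (subsets n))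
    first-vertex-uncovered (suc m) = refl

  signedCount≡shift : ∀ k n m → signedCount k n m ≡ shift k (λ i → signedCount 0 i m) n
  signedCount≡shift zero    n       m = refl
  signedCount≡shift (suc k) zero    m = refl
  signedCount≡shift (suc k) (suc n) m = begin
    signedCount (suc k) (suc n) m
      ≡⟨ sumSubsets-suc n (λ s → weight (suc k) s m) ⟩
    sumSubsets n (λ _ → 0ℤ) +ℤ signedCount k n m
      ≡⟨ cong (_+ℤ signedCount k n m) (sumℤ-map-0 (subsets n)) ⟩
    0ℤ +ℤ signedCount k n m
      ≡⟨ ℤ.+-identityˡ _ ⟩
    signedCount k n m
      ≡⟨ signedCount≡shift k n m ⟩
    shift k (λ i → signedCount 0 i m) n ∎
    where open ≡-Reasoning

  Ucoeff-zero : ∀ m → Ucoeff t 0 m ≡ oneS 0 m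
  Ucoeff-zero zero    = Ucoeff≡signedCount 0 0
  Ucoeff-zero (suc m) = Ucoeff≡signedCount 0 (suc m)

  Ucoeff-suc : ∀ n m →
    Ucoeff t (suc n) m ≡ shift 1 (Ucoeff t n) m +ℤ - shift t (λ i → Ucoeff t i m) n
  Ucoeff-suc n m = begin
    Ucoeff t (suc n) m
      ≡⟨ Ucoeff≡signedCount (suc n) m ⟩
    signedCount 0 (suc n) m
      ≡⟨ signedCount-suc n m ⟩
    shift 1 (signedCount 0 n) m +ℤ - signedCount t n m
      ≡⟨ cong (λ x → shift 1 (signedCount 0 n) m +ℤ - x) (signedCount≡shift t n m) ⟩
    shift 1 (signedCount 0 n) m +ℤ - shift t (λ i → signedCount 0 i m) n
      ≡⟨ cong₂ (λ x y → x +ℤ - y) (shift-cong 1 (Ucoeff≡signedCount n) m)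
                                   (shift-cong t (λ i → Ucoeff≡signedCount i m) n) ⟨
    shift 1 (Ucoeff t n) m +ℤ - shift t (λ i → Ucoeff t i m) n ∎
    where open ≡-Reasoning

proposition3p3 : (t : ℕ) → 1 ≤ t → (n m : ℕ) →
    (UGF t ⊛ (oneS ⊖ ((xS ⊛ zS) ⊖ powS zS (suc t)))) n m ≡ oneS n m
proposition3p3 t _ = recurrence⇒⊛-inverse t (UGF t) Ucoeff-zero Ucoeff-suc
  where open Packings t
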